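{- The class $\mathcal{L}^1$ of graphs representable by $1$-local words is exactly the class of threshold graphs.
   Context: For a word $w$, two distinct letters $\mathtt a,\mathtt b$ alternate in $w$ if, after deleting all other letters, the result is one of $(\mathtt{ab})^n$, $(\mathtt{ab})^n\mathtt a$, $(\mathtt{ba})^n$, $(\mathtt{ba})^n\mathtt b$ for some $n\ge 1$. A graph $G=(V,E)$ is represented by $w$ if the set of letters occurring in $w$ is $V$ and for all $\mathtt a,\mathtt b\in V$: $\mathtt a,\mathtt b$ alternate in $w$ iff $\{\mathtt a,\mathtt b\}\in E$. A marking sequence for $w$ is an enumeration $(\mathtt a_1,\dots,\mathtt a_n)$ of the distinct letters of $w$; at stage $i$ all occurrences of $\mathtt a_1,\dots,\mathtt a_i$ are marked, and a marked block is a maximal factor of consecutive marked positions. $w$ is $k$-local if some marking sequence yields at most $k$ marked blocks at every stage. $\mathcal L^k$ is the class of graphs represented by some $k$-local word. A threshold graph is a graph that can be constructed from the empty graph by repeatedly adding either an isolated node or a node adjacent to all existing nodes. -}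

module Defs where

open import Data.Nat using (ℕ; zero; suc; _≤_; _+_)
open import Data.Fin using (Fin; zero; suc)
open import Data.Fin.Properties using (_≟_)
open import Data.Bool using (Bool; true; false; _∨_; not; if_then_else_)
open import Data.List using (List; []; _∷_; _++_; concat; replicate; filterᵇ; take; length)
open import Data.List.Membership.Propositional using (_∈_)
open import Data.List.Relation.Unary.Unique.Propositional using (Unique)
open import Data.Product using (Σ; _×_; _,_; ∃; ∃-syntax)
open import Data.Sum using (_⊎_)
open import Relation.Nullary using (¬_)
open import Relation.Nullary.Decidable using (⌊_⌋)
open import Relation.Binary.PropositionalEquality using (_≡_; _≢_)
open import Function.Bundles using (_⇔_; _↔_; Inverse)

record Graph (n : ℕ) : Set where
  field
    adj   : Fin n → Fin n → Bool
    sym   : ∀ u v → adj u v ≡ adj v u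
    irrefl : ∀ v → adj v v ≡ false
open Graph public

_≅_ : ∀ {n} → Graph n → Graph n → Set
_≅_ {n} G H = Σ (Fin n ↔ Fin n) λ f →
  ∀ u v → adj G u v ≡ adj H (Inverse.to f u) (Inverse.to f v)

-- Threshold graphs: built from the empty graph by repeatedly adding an
-- isolated node or a dominating node (the new node is index 0).

addIsolated : ∀ {n} → Graph n → Graph (suc n)
addIsolated G = record { adj = a ; sym = s ; irrefl = i }
  where
  a : _ → _ → Bool
  a zero    zero    = false
  a zero    (suc v) = false
  a (suc u) zero    = false
  a (suc u) (suc v) = adj G u v
  s : ∀ u v → a u v ≡ a v u
  s zero zero = Relation.Binary.PropositionalEquality.refl
  s zero (suc v) = Relation.Binary.PropositionalEquality.refl
  s (suc u) zero = Relation.Binary.PropositionalEquality.refl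
  s (suc u) (suc v) = sym G u v
  i : ∀ v → a v v ≡ false
  i zero = Relation.Binary.PropositionalEquality.refl
  i (suc v) = irrefl G v

addDominating : ∀ {n} → Graph n → Graph (suc n)
addDominating G = record { adj = a ; sym = s ; irrefl = i }
  where
  a : _ → _ → Bool
  a zero    zero    = false
  a zero    (suc v) = true
  a (suc u) zero    = true
  a (suc u) (suc v) = adj G u v
  s : ∀ u v → a u v ≡ a v u
  s zero zero = Relation.Binary.PropositionalEquality.refl
  s zero (suc v) = Relation.Binary.PropositionalEquality.refl
  s (suc u) zero = Relation.Binary.PropositionalEquality.refl
  s (suc u) (suc v) = sym G u v
  i : ∀ v → a v v ≡ false
  i zero = Relation.Binary.PropositionalEquality.refl
  i (suc v) = irrefl G v

emptyGraph : Graph 0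
emptyGraph = record { adj = λ () ; sym = λ () ; irrefl = λ () }

data Constructed : (n : ℕ) → Graph n → Set where
  empty     : Constructed 0 emptyGraph
  isolated  : ∀ {n G} → Constructed n G → Constructed (suc n) (addIsolated G)
  dominating : ∀ {n G} → Constructed n G → Constructed (suc n) (addDominating G)

IsThreshold : ∀ {n} → Graph n → Set
IsThreshold {n} G = Σ (Graph n) λ H → Constructed n H × (G ≅ H)

Word : ℕ → Set
Word n = List (Fin n)

restrict : ∀ {n} → Fin n → Fin n → Word n → Word n
restrict a b = filterᵇ (λ x → ⌊ x ≟ a ⌋ ∨ ⌊ x ≟ b ⌋)

pow : ∀ {n} → ℕ → Word n → Word n
pow k u = concat (replicate k u)

Alternate : ∀ {n} → Fin n → Fin n → Word n → Set
Alternate a b w = a ≢ b × ∃[ k ] (1 ≤ k ×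
  ( (restrict a b w ≡ pow k (a ∷ b ∷ []))
  ⊎ (restrict a b w ≡ pow k (a ∷ b ∷ []) ++ (a ∷ []))
  ⊎ (restrict a b w ≡ pow k (b ∷ a ∷ []))
  ⊎ (restrict a b w ≡ pow k (b ∷ a ∷ []) ++ (b ∷ []))))

Represents : ∀ {n} → Word n → Graph n → Set
Represents {n} w G = (∀ (v : Fin n) → v ∈ w) ×
  (∀ a b → a ≢ b → (Alternate a b w ⇔ (adj G a b ≡ true)))

IsMarkingSequence : ∀ {n} → Word n → List (Fin n) → Set
IsMarkingSequence w σ = Unique σ × (∀ x → x ∈ σ ⇔ x ∈ w)

elemᵇ : ∀ {n} → Fin n → List (Fin n) → Bool
elemᵇ x []       = false
elemᵇ x (y ∷ ys) = ⌊ x ≟ y ⌋ ∨ elemᵇ x ys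

-- number of maximal factors of marked positions; the flag records
-- whether the previous position is marked
blocksFrom : ∀ {n} → Bool → (Fin n → Bool) → Word n → ℕ
blocksFrom prev m [] = 0
blocksFrom prev m (x ∷ w) with m x
... | true  = (if prev then 0 else 1) + blocksFrom true m w
... | false = blocksFrom false m w

markedBlocks : ∀ {n} → List (Fin n) → Word n → ℕ
markedBlocks marked w = blocksFrom false (λ x → elemᵇ x marked) w

IsLocal : ∀ {n} → ℕ → Word n → Set
IsLocal k w = ∃[ σ ] (IsMarkingSequence w σ ×
  (∀ i → i ≤ length σ → markedBlocks (take i σ) w ≤ k))

InL : ℕ → ∀ {n} → Graph n → Set
InL k {n} G = ∃[ w ] (IsLocal k w × Represents w G)

-- Let a marking sequence σ witness that a word w representing G is 1-local, and rank
-- letters by their position in σ. Just before v is marked, the marked letters are those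
-- of smaller rank and form a single block B, so w = A B C with v outside B and every
-- letter u of smaller rank inside B only. Hence u and v alternate iff u occurs once in w
-- and v at most once in each of A and C: adjacency to a later vertex factors as
-- "u sends ∧ v receives", where sending implies receiving. A vertex that does not
-- receive is isolated; if all receive, the vertex of least rank is isolated or
-- dominating. Removing it and recursing rebuilds G up to isomorphism.
--
-- Conversely, follow the construction of a threshold graph: each new vertex is appended
-- to a left half L and, if it is isolated, also prepended to a right half R. For an
-- older vertex y and the new vertex x, the word L R restricts to y x (x) (y), which
-- alternates iff x is dominating. Marking vertices from newest to oldest, the marked
-- letters are always a suffix of L followed by a prefix of R, a single block.

module Submission where

open import Defs hiding (sym)
open import Data.Nat using (ℕ; zero; suc; _≤_; _<_; _+_; z≤n; s≤s; _≤?_; _<ᵇ_)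
open import Data.Nat.Properties
  using (+-identityʳ; m≤m+n; m≤n+m; <⇒<ᵇ; n≤0⇒n≡0; ≤-pred; ≤-antisym; <-irrefl; ≤-refl; ≤-trans; <⇒≤; ≰⇒>; <-cmp; ≤∧≢⇒<)
  renaming (suc-injective to suc-injectiveℕ; _≟_ to _≟ℕ_)
open import Data.Fin using (Fin; zero; suc; toℕ)
open import Data.Fin.Properties using (_≟_; any?; suc-injective)
open import Data.Fin.Permutation using (Permutation′; _⟨$⟩ʳ_; _⟨$⟩ˡ_; inverseˡ; lift₀; transpose; flip; _∘ₚ_)
import Data.Fin.Permutation as Permutation
open import Data.Bool using (Bool; true; false; _∧_; _∨_; T; if_then_else_)
open import Data.Bool.Properties using (∧-zeroʳ; ∧-identityʳ; ∨-comm; not-¬; T-≡) renaming (_≟_ to _≟ᵇ_)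
open import Data.List using (List; []; _∷_; _++_; map; replicate; take; length; allFin; tabulate)
open import Data.List.Properties
  using (map-id; ++-identityʳ; ++-assoc; map-tabulate; take-map; length-map; filter-++; filter-≐; map-++; map-injective)
open import Data.List.Membership.Propositional using (_∈_)
open import Data.List.Membership.Propositional.Properties using (∈-map⁺; ∈-map⁻; ∈-++⁺ˡ; ∈-allFin)
import Data.List.Relation.Unary.Unique.Propositional.Properties as Unique
open import Data.List.Relation.Unary.All as All using (All; []; _∷_)
import Data.List.Relation.Unary.All.Properties as AllP
open import Data.List.Relation.Unary.Linked as Linked using (Linked; []; [-]; _∷_)
open import Data.List.Relation.Unary.Any using (here; there)
open import Data.Product using (_×_; _,_; ∃₂; ∃-syntax; proj₁; proj₂)
open import Data.Sum as Sum using (inj₁; inj₂)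
open import Data.Empty using (⊥-elim)
open import Function.Base using (_∘_; id)
open import Function.Construct.Composition using (_⇔-∘_)
open import Function.Construct.Symmetry using (⇔-sym)
open import Function.Bundles using (Injection; _⇔_; mk⇔; Equivalence)
open import Function.Definitions using (Injective)
open import Function.Properties.Inverse using (↔⇒↣)
open import Relation.Nullary using (Dec; does; yes; no)
open import Relation.Nullary.Decidable using (⌊_⌋; T?; _×-dec_; dec-true)
open import Relation.Binary using (tri<; tri≈; tri>)
open import Relation.Binary.PropositionalEquality

relabel : ∀ {m n} → Graph n → (Fin m → Fin n) → Graph m
relabel G g = record
  { adj    = λ u v → adj G (g u) (g v)
  ; sym    = λ u v → Graph.sym G (g u) (g v)
  ; irrefl = λ v → irrefl G (g v)
  }

addVertex : ∀ {n} → Bool → Graph n → Graph (suc n)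
addVertex true  = addDominating
addVertex false = addIsolated

addVertex-zero-zero : ∀ {n} β (G : Graph n) → adj (addVertex β G) zero zero ≡ false
addVertex-zero-zero true  G = refl
addVertex-zero-zero false G = refl

addVertex-zero-suc : ∀ {n} β (G : Graph n) v → adj (addVertex β G) zero (suc v) ≡ β
addVertex-zero-suc true  G v = refl
addVertex-zero-suc false G v = refl

addVertex-suc-zero : ∀ {n} β (G : Graph n) u → adj (addVertex β G) (suc u) zero ≡ β
addVertex-suc-zero true  G u = refl
addVertex-suc-zero false G u = refl

addVertex-suc-suc : ∀ {n} β (G : Graph n) u v → adj (addVertex β G) (suc u) (suc v) ≡ adj G u v
addVertex-suc-suc true  G u v = refl
addVertex-suc-suc false G u v = refl

≅-trans : ∀ {n} {G H K : Graph n} → G ≅ H → H ≅ K → G ≅ K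
≅-trans (π , G≅H) (ρ , H≅K) = π ∘ₚ ρ , λ u v → trans (G≅H u v) (H≅K (π ⟨$⟩ʳ u) (π ⟨$⟩ʳ v))

≅-relabel : ∀ {n} (π : Permutation′ n) (G : Graph n) → G ≅ relabel G (π ⟨$⟩ˡ_)
≅-relabel π G = π , λ u v → sym (cong₂ (adj G) (inverseˡ π) (inverseˡ π))

addVertex-≅ : ∀ {n} β {G H : Graph n} → G ≅ H → addVertex β G ≅ addVertex β H
addVertex-≅ β {G} {H} (π , G≅H) = lift₀ π , lifted
  where
  lifted : ∀ u v → adj (addVertex β G) u v ≡ adj (addVertex β H) (lift₀ π ⟨$⟩ʳ u) (lift₀ π ⟨$⟩ʳ v)
  lifted zero    zero    = trans (addVertex-zero-zero β G) (sym (addVertex-zero-zero β H))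
  lifted zero    (suc v) = trans (addVertex-zero-suc β G v) (sym (addVertex-zero-suc β H _))
  lifted (suc u) zero    = trans (addVertex-suc-zero β G u) (sym (addVertex-suc-zero β H _))
  lifted (suc u) (suc v) = begin
    adj (addVertex β G) (suc u) (suc v)             ≡⟨ addVertex-suc-suc β G u v ⟩
    adj G u v                                       ≡⟨ G≅H u v ⟩
    adj H (π ⟨$⟩ʳ u) (π ⟨$⟩ʳ v)                      ≡⟨ sym (addVertex-suc-suc β H _ _) ⟩
    adj (addVertex β H) (suc (π ⟨$⟩ʳ u)) (suc (π ⟨$⟩ʳ v)) ∎
    where open ≡-Reasoning

Uniform : ∀ {n} → Graph n → Fin n → Bool → Set
Uniform G i β = ∀ v → v ≢ i → adj G i v ≡ β

uniform-zero⇒≅-addVertex : ∀ {n} (G : Graph (suc n)) β → Uniform G zero β → G ≅ addVertex β (relabel G suc)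
uniform-zero⇒≅-addVertex G β uniform = Permutation.id , same
  where
  same : ∀ u v → adj G u v ≡ adj (addVertex β (relabel G suc)) u v
  same zero    zero    = trans (irrefl G zero) (sym (addVertex-zero-zero β (relabel G suc)))
  same zero    (suc v) = trans (uniform (suc v) λ ()) (sym (addVertex-zero-suc β _ v))
  same (suc u) zero    = trans (Graph.sym G (suc u) zero)
                           (trans (same zero (suc u)) (Graph.sym (addVertex β (relabel G suc)) zero (suc u)))
  same (suc u) (suc v) = sym (addVertex-suc-suc β _ u v)

IsThreshold-≅ : ∀ {n} {G H : Graph n} → G ≅ H → IsThreshold H → IsThreshold G
IsThreshold-≅ {G = G} {H} G≅H (K , constructed , H≅K) = K , constructed , ≅-trans {G = G} {H} {K} G≅H H≅K

IsThreshold-addVertex : ∀ {n} β {G : Graph n} → IsThreshold G → IsThreshold (addVertex β G)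
IsThreshold-addVertex β (H , constructed , G≅H) = addVertex β H , construct β constructed , addVertex-≅ β G≅H
  where
  construct : ∀ β → Constructed _ H → Constructed _ (addVertex β H)
  construct true  = dominating
  construct false = isolated

threshold-by-peeling : ∀ {n} (G : Graph (suc n)) i β → Uniform G i β →
  IsThreshold (relabel G (λ v → transpose i zero ⟨$⟩ˡ suc v)) → IsThreshold G
threshold-by-peeling G i β uniform rest-threshold = IsThreshold-≅ {G = G} {G′} (≅-relabel τ G) G′-threshold
  where
  -- The inverse of τ sends 0 to i, so relabelling by it moves the uniform vertex to 0.
  τ = transpose i zero
  G′ = relabel G (τ ⟨$⟩ˡ_)
  uniform′ : Uniform G′ zero β
  uniform′ v v≢0 = uniform (τ ⟨$⟩ˡ v) (v≢0 ∘ Injection.injective (↔⇒↣ (flip τ)))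
  G′-threshold : IsThreshold G′
  G′-threshold = IsThreshold-≅ {G = G′} {addVertex β (relabel G′ suc)}
                   (uniform-zero⇒≅-addVertex G′ β uniform′) (IsThreshold-addVertex β rest-threshold)

∃-minimum : ∀ {n} (f : Fin (suc n) → ℕ) → ∃[ i ] ∀ j → f i ≤ f j
∃-minimum {zero}  f = zero , λ { zero → ≤-refl }
∃-minimum {suc n} f with ∃-minimum (f ∘ suc)
... | i , fi≤ with f zero ≤? f (suc i)
...   | yes f0≤fi = zero  , λ { zero → ≤-refl ; (suc j) → ≤-trans f0≤fi (fi≤ j) }
...   | no  f0≰fi = suc i , λ { zero → <⇒≤ (≰⇒> f0≰fi) ; (suc j) → fi≤ j }

record ThresholdRanking {n} (G : Graph n) : Set where
  field
    rank           : Fin n → ℕ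
    rank-injective : Injective _≡_ _≡_ rank
    sends receives : Fin n → Bool
    sends⇒receives : ∀ v → sends v ≡ true → receives v ≡ true
    adj-ranked     : ∀ u v → rank u < rank v → adj G u v ≡ sends u ∧ receives v

  nonreceiver-isolated : ∀ i → receives i ≡ false → Uniform G i false
  nonreceiver-isolated i i-rejects v v≢i with <-cmp (rank i) (rank v)
  ... | tri< i<v _ _ = trans (adj-ranked i v i<v) (cong (_∧ receives v) i-silent)
    where
    i-silent : sends i ≡ false
    i-silent with sends i in i-sends
    ... | false = refl
    ... | true  = trans (sym (sends⇒receives i i-sends)) i-rejects
  ... | tri≈ _ i=v _ = ⊥-elim (v≢i (sym (rank-injective i=v)))
  ... | tri> _ _ v<i = begin
    adj G i v              ≡⟨ Graph.sym G i v ⟩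
    adj G v i              ≡⟨ adj-ranked v i v<i ⟩
    sends v ∧ receives i   ≡⟨ cong (sends v ∧_) i-rejects ⟩
    sends v ∧ false        ≡⟨ ∧-zeroʳ (sends v) ⟩
    false                  ∎
    where open ≡-Reasoning

  first-uniform : (∀ v → receives v ≡ true) → ∀ i → (∀ v → rank i ≤ rank v) → Uniform G i (sends i)
  first-uniform all-receive i i-first v v≢i = begin
    adj G i v             ≡⟨ adj-ranked i v (≤∧≢⇒< (i-first v) (v≢i ∘ sym ∘ rank-injective)) ⟩
    sends i ∧ receives v  ≡⟨ cong (sends i ∧_) (all-receive v) ⟩
    sends i ∧ true        ≡⟨ ∧-identityʳ (sends i) ⟩
    sends i               ∎
    where open ≡-Reasoning

module _ {n} {G : Graph (suc n)} (R : ThresholdRanking G) where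
  open ThresholdRanking R

  ∃-uniform : ∃[ i ] ∃[ β ] Uniform G i β
  ∃-uniform with any? (λ v → receives v ≟ᵇ false)
  ... | yes (i , i-rejects) = i , false , nonreceiver-isolated i i-rejects
  ... | no  none-rejects    = i , sends i , first-uniform all-receive i i-first
    where
    i = proj₁ (∃-minimum rank)
    i-first = proj₂ (∃-minimum rank)
    all-receive : ∀ v → receives v ≡ true
    all-receive v with receives v in v-receives
    ... | true  = refl
    ... | false = ⊥-elim (none-rejects (v , v-receives))

ThresholdRanking-relabel : ∀ {m n} {G : Graph n} {g : Fin m → Fin n} → Injective _≡_ _≡_ g →
  ThresholdRanking G → ThresholdRanking (relabel G g)
ThresholdRanking-relabel {g = g} g-injective R = record
  { rank           = rank ∘ g
  ; rank-injective = g-injective ∘ rank-injective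
  ; sends          = sends ∘ g
  ; receives       = receives ∘ g
  ; sends⇒receives = sends⇒receives ∘ g
  ; adj-ranked     = λ u v → adj-ranked (g u) (g v)
  }
  where open ThresholdRanking R

ranking⇒threshold : ∀ {n} {G : Graph n} → ThresholdRanking G → IsThreshold G
ranking⇒threshold {zero}  {G} _ = emptyGraph , empty , Permutation.id , λ ()
ranking⇒threshold {suc n} {G} R with ∃-uniform R
... | i , β , uniform = threshold-by-peeling G i β uniform
  (ranking⇒threshold (ThresholdRanking-relabel (suc-injective ∘ Injection.injective (↔⇒↣ (flip (transpose i zero)))) R))

count : ∀ {n} → Fin n → Word n → ℕ
count v []      = 0
count v (x ∷ w) = if ⌊ x ≟ v ⌋ then suc (count v w) else count v w

module _ {n} (v : Fin n) where

  count-++ : ∀ w w′ → count v (w ++ w′) ≡ count v w + count v w′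
  count-++ []      w′ = refl
  count-++ (x ∷ w) w′ with x ≟ v
  ... | yes _ = cong suc (count-++ w w′)
  ... | no  _ = count-++ w w′

  count-absent : ∀ {w} → All (_≢ v) w → count v w ≡ 0
  count-absent {[]}    []              = refl
  count-absent {x ∷ w} (x≢v ∷ w≢v) with x ≟ v
  ... | yes x≡v = ⊥-elim (x≢v x≡v)
  ... | no  _   = count-absent w≢v

  ∈⇒count>0 : ∀ {w} → v ∈ w → 0 < count v w
  ∈⇒count>0 {x ∷ w} v∈ with x ≟ v
  ∈⇒count>0 {x ∷ w} v∈          | yes _   = s≤s z≤n
  ∈⇒count>0 {x ∷ w} (here v≡x)  | no  x≢v = ⊥-elim (x≢v (sym v≡x))
  ∈⇒count>0 {x ∷ w} (there v∈w) | no  _   = ∈⇒count>0 v∈w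

  count>0⇒∈ : ∀ {w} → 0 < count v w → v ∈ w
  count>0⇒∈ {x ∷ w} count>0 with x ≟ v
  ... | yes x≡v = here (sym x≡v)
  ... | no  _   = there (count>0⇒∈ count>0)

  count-sandwich : ∀ {A C} B → All (_≢ v) A → All (_≢ v) C → count v (A ++ B ++ C) ≡ count v B
  count-sandwich {A} {C} B A≢v C≢v = begin
    count v (A ++ B ++ C)              ≡⟨ count-++ A (B ++ C) ⟩
    count v A + count v (B ++ C)       ≡⟨ cong₂ _+_ (count-absent A≢v) (count-++ B C) ⟩
    count v B + count v C              ≡⟨ cong (count v B +_) (count-absent C≢v) ⟩
    count v B + 0                      ≡⟨ +-identityʳ (count v B) ⟩
    count v B                          ∎
    where open ≡-Reasoning

  count-around : ∀ A {B} C → All (_≢ v) B → count v (A ++ B ++ C) ≡ count v A + count v C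
  count-around A {B} C B≢v = begin
    count v (A ++ B ++ C)              ≡⟨ count-++ A (B ++ C) ⟩
    count v A + count v (B ++ C)       ≡⟨ cong (count v A +_) (count-++ B C) ⟩
    count v A + (count v B + count v C) ≡⟨ cong (λ k → count v A + (k + count v C)) (count-absent B≢v) ⟩
    count v A + count v C              ∎
    where open ≡-Reasoning

⌊≟⌋-map : ∀ {m n} {g : Fin m → Fin n} → Injective _≡_ _≡_ g →
  ∀ x y → ⌊ g x ≟ g y ⌋ ≡ ⌊ x ≟ y ⌋
⌊≟⌋-map {g = g} g-injective x y with g x ≟ g y | x ≟ y
... | yes _     | yes _   = refl
... | no  _     | no  _   = refl
... | yes gx≡gy | no  x≢y = ⊥-elim (x≢y (g-injective gx≡gy))
... | no  gx≢gy | yes x≡y = ⊥-elim (gx≢gy (cong g x≡y))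

count-map : ∀ {m n} {g : Fin m → Fin n} → Injective _≡_ _≡_ g → ∀ v w → count (g v) (map g w) ≡ count v w
count-map g-injective v []      = refl
count-map g-injective v (x ∷ w) rewrite ⌊≟⌋-map g-injective x v with ⌊ x ≟ v ⌋
... | true  = cong suc (count-map g-injective v w)
... | false = count-map g-injective v w

restrict-++ : ∀ {n} (a b : Fin n) w w′ → restrict a b (w ++ w′) ≡ restrict a b w ++ restrict a b w′
restrict-++ a b = filter-++ (λ x → T? (⌊ x ≟ a ⌋ ∨ ⌊ x ≟ b ⌋))

restrict-sym : ∀ {n} (a b : Fin n) w → restrict a b w ≡ restrict b a w
restrict-sym a b = filter-≐ (λ x → T? (⌊ x ≟ a ⌋ ∨ ⌊ x ≟ b ⌋)) (λ x → T? (⌊ x ≟ b ⌋ ∨ ⌊ x ≟ a ⌋))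
  ((λ {x} → subst T (∨-comm ⌊ x ≟ a ⌋ ⌊ x ≟ b ⌋))
  , (λ {x} → subst T (∨-comm ⌊ x ≟ b ⌋ ⌊ x ≟ a ⌋)))

restrict-without : ∀ {n} (a b : Fin n) {w} → All (_≢ a) w → restrict a b w ≡ replicate (count b w) b
restrict-without a b {[]}    []              = refl
restrict-without a b {x ∷ w} (x≢a ∷ w≢a) with x ≟ a
... | yes x≡a = ⊥-elim (x≢a x≡a)
... | no  _ with x ≟ b
...   | yes refl = cong (b ∷_) (restrict-without a b w≢a)
...   | no  _    = restrict-without a b w≢a

restrict-sandwich : ∀ {n} (u v : Fin n) A B C → All (_≢ u) A → All (_≢ v) B → All (_≢ u) C →
  restrict u v (A ++ B ++ C) ≡ replicate (count v A) v ++ replicate (count u B) u ++ replicate (count v C) v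
restrict-sandwich u v A B C A≢u B≢v C≢u = begin
  restrict u v (A ++ B ++ C)
    ≡⟨ restrict-++ u v A (B ++ C) ⟩
  restrict u v A ++ restrict u v (B ++ C)
    ≡⟨ cong (restrict u v A ++_) (restrict-++ u v B C) ⟩
  restrict u v A ++ restrict u v B ++ restrict u v C
    ≡⟨ cong₂ (λ X Y → restrict u v A ++ X ++ Y) (restrict-sym u v B) (restrict-without u v C≢u) ⟩
  restrict u v A ++ restrict v u B ++ replicate (count v C) v
    ≡⟨ cong₂ (λ X Y → X ++ Y ++ replicate (count v C) v) (restrict-without u v A≢u) (restrict-without v u B≢v) ⟩
  replicate (count v A) v ++ replicate (count u B) u ++ replicate (count v C) v ∎
  where open ≡-Reasoning

restrict-map : ∀ {m n} {g : Fin m → Fin n} → Injective _≡_ _≡_ g → ∀ a b w →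
  restrict (g a) (g b) (map g w) ≡ map g (restrict a b w)
restrict-map g-injective a b [] = refl
restrict-map {g = g} g-injective a b (x ∷ w)
  rewrite ⌊≟⌋-map g-injective x a | ⌊≟⌋-map g-injective x b with ⌊ x ≟ a ⌋ ∨ ⌊ x ≟ b ⌋
... | true  = cong (g x ∷_) (restrict-map g-injective a b w)
... | false = restrict-map g-injective a b w

-- Alternation

module _ {A : Set} {R : A → A → Set} where

  Linked-++⁻ˡ : ∀ xs {ys} → Linked R (xs ++ ys) → Linked R xs
  Linked-++⁻ˡ []           _          = []
  Linked-++⁻ˡ (x ∷ [])     _          = [-]
  Linked-++⁻ˡ (x ∷ y ∷ xs) (Rxy ∷ Rs) = Rxy ∷ Linked-++⁻ˡ (y ∷ xs) Rs

  Linked-++⁻ʳ : ∀ xs {ys} → Linked R (xs ++ ys) → Linked R ys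
  Linked-++⁻ʳ []       Rs = Rs
  Linked-++⁻ʳ (x ∷ xs) Rs = Linked-++⁻ʳ xs (Linked.tail Rs)

Linked-replicate⇒≤1 : ∀ {A : Set} k {x : A} → Linked _≢_ (replicate k x) → k ≤ 1
Linked-replicate⇒≤1 zero          _          = z≤n
Linked-replicate⇒≤1 (suc zero)    _          = s≤s z≤n
Linked-replicate⇒≤1 (suc (suc k)) (x≢x ∷ _) = ⊥-elim (x≢x refl)

module _ {n} {x y : Fin n} where

  pow-rotate : ∀ k → pow k (x ∷ y ∷ []) ++ x ∷ [] ≡ x ∷ pow k (y ∷ x ∷ [])
  pow-rotate zero    = refl
  pow-rotate (suc k) = cong (λ w → x ∷ y ∷ w) (pow-rotate k)

  Linked-rotated : x ≢ y → ∀ k → Linked _≢_ (x ∷ pow k (y ∷ x ∷ []))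
  Linked-rotated x≢y zero    = [-]
  Linked-rotated x≢y (suc k) = x≢y ∷ (x≢y ∘ sym) ∷ Linked-rotated x≢y k

  Linked-odd : x ≢ y → ∀ k → Linked _≢_ (pow k (x ∷ y ∷ []) ++ x ∷ [])
  Linked-odd x≢y k = subst (Linked _≢_) (sym (pow-rotate k)) (Linked-rotated x≢y k)

  Linked-even : x ≢ y → ∀ k → Linked _≢_ (pow k (x ∷ y ∷ []))
  Linked-even x≢y k = Linked-++⁻ˡ (pow k (x ∷ y ∷ [])) (Linked-odd x≢y k)

Alternate⇒Linked : ∀ {n} {a b : Fin n} {w} → Alternate a b w → Linked _≢_ (restrict a b w)
Alternate⇒Linked (a≢b , k , _ , inj₁ r≡)               = subst (Linked _≢_) (sym r≡) (Linked-even a≢b k)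
Alternate⇒Linked (a≢b , k , _ , inj₂ (inj₁ r≡))        = subst (Linked _≢_) (sym r≡) (Linked-odd a≢b k)
Alternate⇒Linked (a≢b , k , _ , inj₂ (inj₂ (inj₁ r≡))) = subst (Linked _≢_) (sym r≡) (Linked-even (a≢b ∘ sym) k)
Alternate⇒Linked (a≢b , k , _ , inj₂ (inj₂ (inj₂ r≡))) = subst (Linked _≢_) (sym r≡) (Linked-odd (a≢b ∘ sym) k)

Alternate-criterion : ∀ {n} {u v : Fin n} {w} a k b → u ≢ v →
  restrict u v w ≡ replicate a v ++ replicate k u ++ replicate b v → 0 < k → 0 < a + b →
  Alternate u v w ⇔ (k ≡ 1 × a ≤ 1 × b ≤ 1)
Alternate-criterion {u = u} {v} {w} a k b u≢v r≡ k>0 a+b>0 = mk⇔ to from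
  where
  to : Alternate u v w → (k ≡ 1 × a ≤ 1 × b ≤ 1)
  to alternate = ≤-antisym (Linked-replicate⇒≤1 k (Linked-++⁻ˡ (replicate k u) linked-ku)) k>0
               , Linked-replicate⇒≤1 a (Linked-++⁻ˡ (replicate a v) linked)
               , Linked-replicate⇒≤1 b (Linked-++⁻ʳ (replicate k u) linked-ku)
               where
               linked = subst (Linked _≢_) r≡ (Alternate⇒Linked {w = w} alternate)
               linked-ku = Linked-++⁻ʳ (replicate a v) linked
  from : (k ≡ 1 × a ≤ 1 × b ≤ 1) → Alternate u v w
  from (refl , z≤n     , z≤n)     = ⊥-elim (<-irrefl refl a+b>0)
  from (refl , z≤n     , s≤s z≤n) = u≢v , 1 , ≤-refl , inj₁ r≡
  from (refl , s≤s z≤n , z≤n)     = u≢v , 1 , ≤-refl , inj₂ (inj₂ (inj₁ r≡))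
  from (refl , s≤s z≤n , s≤s z≤n) = u≢v , 1 , ≤-refl , inj₂ (inj₂ (inj₂ r≡))

Alternate-sandwich : ∀ {n} {u v : Fin n} A B C → u ≢ v → All (_≢ u) A → All (_≢ v) B → All (_≢ u) C →
  0 < count u B → 0 < count v A + count v C →
  Alternate u v (A ++ B ++ C) ⇔ (count u B ≡ 1 × count v A ≤ 1 × count v C ≤ 1)
Alternate-sandwich {u = u} {v} A B C u≢v A≢u B≢v C≢u =
  Alternate-criterion {w = A ++ B ++ C} (count v A) (count u B) (count v C) u≢v (restrict-sandwich u v A B C A≢u B≢v C≢u)

Alternate-sym : ∀ {n} {a b : Fin n} {w} → Alternate a b w → Alternate b a w
Alternate-sym {a = a} {b} {w} (a≢b , k , k>0 , shape) = a≢b ∘ sym , k , k>0 , swap shape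
  where
  r≡ = restrict-sym b a w
  swap : _ → _
  swap (inj₁ e)               = inj₂ (inj₂ (inj₁ (trans r≡ e)))
  swap (inj₂ (inj₁ e))        = inj₂ (inj₂ (inj₂ (trans r≡ e)))
  swap (inj₂ (inj₂ (inj₁ e))) = inj₁ (trans r≡ e)
  swap (inj₂ (inj₂ (inj₂ e))) = inj₂ (inj₁ (trans r≡ e))

map-pow : ∀ {m n} (g : Fin m → Fin n) k w → map g (pow k w) ≡ pow k (map g w)
map-pow g zero    w = refl
map-pow g (suc k) w = trans (map-++ g w (pow k w)) (cong (map g w ++_) (map-pow g k w))

Alternate-map : ∀ {m n} {g : Fin m → Fin n} → Injective _≡_ _≡_ g → ∀ {a b} {w w′} →
  restrict (g a) (g b) w ≡ map g (restrict a b w′) → Alternate (g a) (g b) w ⇔ Alternate a b w′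
Alternate-map {g = g} g-injective {a} {b} {w} {w′} r≡ = mk⇔ to from
  where
  even-map : ∀ k x y → map g (pow k (x ∷ y ∷ [])) ≡ pow k (g x ∷ g y ∷ [])
  even-map k x y = map-pow g k (x ∷ y ∷ [])
  odd-map : ∀ k x y → map g (pow k (x ∷ y ∷ []) ++ x ∷ []) ≡ pow k (g x ∷ g y ∷ []) ++ g x ∷ []
  odd-map k x y = trans (map-++ g (pow k (x ∷ y ∷ [])) (x ∷ [])) (cong (_++ g x ∷ []) (even-map k x y))
  down : ∀ {p q} → map g p ≡ q → restrict (g a) (g b) w ≡ q → restrict a b w′ ≡ p
  down p↦q r≡q = map-injective g-injective (trans (sym r≡) (trans r≡q (sym p↦q)))
  up : ∀ {p q} → map g p ≡ q → restrict a b w′ ≡ p → restrict (g a) (g b) w ≡ q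
  up p↦q r≡p = trans r≡ (trans (cong (map g) r≡p) p↦q)
  to : Alternate (g a) (g b) w → Alternate a b w′
  to (ga≢gb , k , k>0 , shape) = ga≢gb ∘ cong g , k , k>0 ,
    Sum.map (down (even-map k a b)) (Sum.map (down (odd-map k a b))
      (Sum.map (down (even-map k b a)) (down (odd-map k b a)))) shape
  from : Alternate a b w′ → Alternate (g a) (g b) w
  from (a≢b , k , k>0 , shape) = a≢b ∘ g-injective , k , k>0 ,
    Sum.map (up (even-map k a b)) (Sum.map (up (odd-map k a b))
      (Sum.map (up (even-map k b a)) (up (odd-map k b a)))) shape

-- Marked blocks

Marked Unmarked : ∀ {n} → (Fin n → Bool) → Fin n → Set
Marked   mark x = mark x ≡ true
Unmarked mark x = mark x ≡ false

record SingleBlock {n} (mark : Fin n → Bool) (w : Word n) : Set where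
  field
    before block after : Word n
    split              : w ≡ before ++ block ++ after
    before-unmarked    : All (Unmarked mark) before
    block-marked       : All (Marked mark) block
    after-unmarked     : All (Unmarked mark) after

module _ {n} (mark : Fin n → Bool) where

  blocksFrom-unmarked : ∀ b {w} → All (Unmarked mark) w → blocksFrom b mark w ≡ 0
  blocksFrom-unmarked b {[]}    []          = refl
  blocksFrom-unmarked b {x ∷ w} (mx ∷ w-um) rewrite mx = blocksFrom-unmarked false w-um

  blocksFrom-++-unmarked : ∀ {A} w → All (Unmarked mark) A → blocksFrom false mark (A ++ w) ≡ blocksFrom false mark w
  blocksFrom-++-unmarked {[]}    w []          = refl
  blocksFrom-++-unmarked {x ∷ A} w (mx ∷ A-um) rewrite mx = blocksFrom-++-unmarked w A-um

  blocksFrom-++-marked : ∀ {B} w → All (Marked mark) B → blocksFrom true mark (B ++ w) ≡ blocksFrom true mark w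
  blocksFrom-++-marked {[]}    w []         = refl
  blocksFrom-++-marked {x ∷ B} w (mx ∷ B-m) rewrite mx = blocksFrom-++-marked w B-m

  SingleBlock⇒blocks≤1 : ∀ {w} → SingleBlock mark w → blocksFrom false mark w ≤ 1
  SingleBlock⇒blocks≤1 record { before = A ; block = B ; after = C ; split = refl
                              ; before-unmarked = A-um ; block-marked = B-m ; after-unmarked = C-um }
    rewrite blocksFrom-++-unmarked (B ++ C) A-um = block≤1 B-m
    where
    block≤1 : ∀ {B} → All (Marked mark) B → blocksFrom false mark (B ++ C) ≤ 1
    block≤1 []                 rewrite blocksFrom-unmarked false C-um = z≤n
    block≤1 {x ∷ B} (mx ∷ B-m) rewrite mx | blocksFrom-++-marked C B-m | blocksFrom-unmarked true C-um = s≤s z≤n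

  blocks≡0⇒unmarked : ∀ w → blocksFrom false mark w ≡ 0 → All (Unmarked mark) w
  blocks≡0⇒unmarked []      _ = []
  blocks≡0⇒unmarked (x ∷ w) h with mark x in mx
  ... | false = mx ∷ blocks≡0⇒unmarked w h

  blocks≡0⇒marked-unmarked : ∀ w → blocksFrom true mark w ≡ 0 →
    ∃₂ λ B C → w ≡ B ++ C × All (Marked mark) B × All (Unmarked mark) C
  blocks≡0⇒marked-unmarked []      _ = [] , [] , refl , [] , []
  blocks≡0⇒marked-unmarked (x ∷ w) h with mark x in mx
  ... | false = [] , x ∷ w , refl , [] , mx ∷ blocks≡0⇒unmarked w h
  ... | true with blocks≡0⇒marked-unmarked w h
  ...   | B , C , refl , B-m , C-um = x ∷ B , C , refl , mx ∷ B-m , C-um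

  blocks≤1⇒SingleBlock : ∀ w → blocksFrom false mark w ≤ 1 → SingleBlock mark w
  blocks≤1⇒SingleBlock []      _ = record
    { before = [] ; block = [] ; after = [] ; split = refl
    ; before-unmarked = [] ; block-marked = [] ; after-unmarked = [] }
  blocks≤1⇒SingleBlock (x ∷ w) h with mark x in mx
  ... | false = record
    { before = x ∷ before ; block = block ; after = after ; split = cong (x ∷_) split
    ; before-unmarked = mx ∷ before-unmarked ; block-marked = block-marked ; after-unmarked = after-unmarked }
    where open SingleBlock (blocks≤1⇒SingleBlock w h)
  ... | true with blocks≡0⇒marked-unmarked w (n≤0⇒n≡0 (≤-pred h))
  ...   | B , C , refl , B-m , C-um = record
    { before = [] ; block = x ∷ B ; after = C ; split = refl
    ; before-unmarked = [] ; block-marked = mx ∷ B-m ; after-unmarked = C-um }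

module _ {m n} {g : Fin m → Fin n} where

  blocksFrom-map : ∀ {mark : Fin n → Bool} {mark′ : Fin m → Bool} → (∀ x → mark (g x) ≡ mark′ x) →
    ∀ b w → blocksFrom b mark (map g w) ≡ blocksFrom b mark′ w
  blocksFrom-map         g-mark b []      = refl
  blocksFrom-map {mark′ = mark′} g-mark b (x ∷ w) rewrite g-mark x with mark′ x
  ... | true  = cong ((if b then 0 else 1) +_) (blocksFrom-map g-mark true w)
  ... | false = blocksFrom-map g-mark false w

blocksFrom-cong : ∀ {n} {mark mark′ : Fin n → Bool} → (∀ x → mark x ≡ mark′ x) →
  ∀ b w → blocksFrom b mark w ≡ blocksFrom b mark′ w
blocksFrom-cong {mark = mark} mark≗ b w = trans (cong (blocksFrom b mark) (sym (map-id w))) (blocksFrom-map mark≗ b w)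

record Split {A : Set} (P Q : A → Set) (xs : List A) : Set where
  field
    front back : List A
    split      : xs ≡ front ++ back
    front-P    : All P front
    back-Q     : All Q back

module _ {A : Set} {P Q : A → Set} where

  Split-front : ∀ {xs} → All P xs → Split P Q xs
  Split-front {xs} P-xs = record { front = xs ; back = [] ; split = sym (++-identityʳ xs) ; front-P = P-xs ; back-Q = [] }

  Split-back : ∀ {xs} → All Q xs → Split P Q xs
  Split-back {xs} Q-xs = record { front = [] ; back = xs ; split = refl ; front-P = [] ; back-Q = Q-xs }

  Split-prepend : ∀ {xs ys} → All P ys → Split P Q xs → Split P Q (ys ++ xs)
  Split-prepend {ys = ys} P-ys S = record
    { front = ys ++ front ; back = back ; split = trans (cong (ys ++_) split) (sym (++-assoc ys front back))
    ; front-P = AllP.++⁺ P-ys front-P ; back-Q = back-Q }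
    where open Split S

  Split-append : ∀ {xs ys} → Split P Q xs → All Q ys → Split P Q (xs ++ ys)
  Split-append {ys = ys} S Q-ys = record
    { front = front ; back = back ++ ys ; split = trans (cong (_++ ys) split) (++-assoc front back ys)
    ; front-P = front-P ; back-Q = AllP.++⁺ back-Q Q-ys }
    where open Split S

  Split-map : ∀ {B : Set} {f : B → A} {xs} → Split (P ∘ f) (Q ∘ f) xs → Split P Q (map f xs)
  Split-map {f = f} S = record
    { front = map f front ; back = map f back ; split = trans (cong (map f) split) (map-++ f front back)
    ; front-P = AllP.map⁺ front-P ; back-Q = AllP.map⁺ back-Q }
    where open Split S

Splits⇒SingleBlock : ∀ {n} {mark : Fin n → Bool} {L R} →
  Split (Unmarked mark) (Marked mark) L → Split (Marked mark) (Unmarked mark) R → SingleBlock mark (L ++ R)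
Splits⇒SingleBlock SL SR = record
  { before = SL.front ; block = SL.back ++ SR.front ; after = SR.back
  ; split = trans (cong₂ _++_ SL.split SR.split)
              (trans (++-assoc SL.front SL.back (SR.front ++ SR.back))
                     (cong (SL.front ++_) (sym (++-assoc SL.back SR.front SR.back))))
  ; before-unmarked = SL.front-P ; block-marked = AllP.++⁺ SL.back-Q SR.front-P ; after-unmarked = SR.back-Q }
  where
  module SL = Split SL
  module SR = Split SR

position : ∀ {n} → Fin n → List (Fin n) → ℕ
position x []      = 0
position x (y ∷ σ) = if ⌊ x ≟ y ⌋ then 0 else suc (position x σ)

module _ {n} {x : Fin n} where

  position-< : ∀ {σ} → x ∈ σ → position x σ < length σ
  position-< {y ∷ σ} x∈ with x ≟ y
  position-< {y ∷ σ} x∈          | yes _   = s≤s z≤n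
  position-< {y ∷ σ} (here x≡y)  | no  x≢y = ⊥-elim (x≢y x≡y)
  position-< {y ∷ σ} (there x∈σ) | no  _   = s≤s (position-< x∈σ)

  position-injective : ∀ {y σ} → x ∈ σ → y ∈ σ → position x σ ≡ position y σ → x ≡ y
  position-injective {y} {z ∷ σ} x∈ y∈ p≡ with x ≟ z | y ≟ z
  ... | yes x≡z | yes y≡z = trans x≡z (sym y≡z)
  position-injective {y} {z ∷ σ} (here x≡z)  _           p≡ | no x≢z | _       = ⊥-elim (x≢z x≡z)
  position-injective {y} {z ∷ σ} _           (here y≡z)  p≡ | _      | no y≢z  = ⊥-elim (y≢z y≡z)
  position-injective {y} {z ∷ σ} (there x∈σ) (there y∈σ) p≡ | no _   | no _    =
    position-injective x∈σ y∈σ (suc-injectiveℕ p≡)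

  elemᵇ-take : ∀ {σ} → x ∈ σ → ∀ i → elemᵇ x (take i σ) ≡ (position x σ <ᵇ i)
  elemᵇ-take {y ∷ σ} x∈ zero = refl
  elemᵇ-take {y ∷ σ} x∈ (suc i) with x ≟ y
  elemᵇ-take {y ∷ σ} x∈          (suc i) | yes _   = refl
  elemᵇ-take {y ∷ σ} (here x≡y)  (suc i) | no  x≢y = ⊥-elim (x≢y x≡y)
  elemᵇ-take {y ∷ σ} (there x∈σ) (suc i) | no  _   = elemᵇ-take x∈σ i

position-map : ∀ {m n} {g : Fin m → Fin n} → Injective _≡_ _≡_ g →
  ∀ x σ → position (g x) (map g σ) ≡ position x σ
position-map g-injective x []      = refl
position-map g-injective x (y ∷ σ) rewrite ⌊≟⌋-map g-injective x y with ⌊ x ≟ y ⌋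
... | true  = refl
... | false = cong suc (position-map g-injective x σ)

position-allFin : ∀ {n} (x : Fin n) → position x (allFin n) ≡ toℕ x
position-allFin {suc n} zero    = refl
position-allFin {suc n} (suc x) = cong suc (begin
  position (suc x) (tabulate suc)         ≡⟨ cong (position (suc x)) (sym (map-tabulate id suc)) ⟩
  position (suc x) (map suc (allFin n))   ≡⟨ position-map suc-injective x (allFin n) ⟩
  position x (allFin n)                   ≡⟨ position-allFin x ⟩
  toℕ x                                   ∎)
  where open ≡-Reasoning

markedBlocks-position : ∀ {n} {σ : List (Fin n)} → (∀ x → x ∈ σ) → ∀ i w →
  markedBlocks (take i σ) w ≡ blocksFrom false (λ x → position x σ <ᵇ i) w
markedBlocks-position σ-complete i = blocksFrom-cong (λ x → elemᵇ-take (σ-complete x) i) false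

-- From 1-local words to threshold graphs

≢-by-mark : ∀ {n} {mark : Fin n → Bool} {b u A} → mark u ≢ b → All (λ x → mark x ≡ b) A → All (_≢ u) A
≢-by-mark {mark = mark} {b} mu≢b = All.map (λ mx≡b x≡u → mu≢b (subst (λ y → mark y ≡ b) x≡u mx≡b))

<ᵇ-irrefl : ∀ k → (k <ᵇ k) ≡ false
<ᵇ-irrefl zero    = refl
<ᵇ-irrefl (suc k) = <ᵇ-irrefl k

≡-does : ∀ {X : Set} {b} (X? : Dec X) → (b ≡ true ⇔ X) → b ≡ does X?
≡-does         (yes x) b⇔X = Equivalence.from b⇔X x
≡-does {b = false} (no ¬x) b⇔X = refl
≡-does {b = true}  (no ¬x) b⇔X = ⊥-elim (¬x (Equivalence.to b⇔X refl))

does-true : ∀ {X : Set} (X? : Dec X) → does X? ≡ true → X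
does-true (yes x) _ = x

module OneLocalRepresentation {n} {G : Graph n} {w : Word n} {σ : List (Fin n)}
  (σ-complete : ∀ x → x ∈ σ)
  (one-local : ∀ i → i ≤ length σ → markedBlocks (take i σ) w ≤ 1)
  (w-complete : ∀ x → x ∈ w)
  (alternate⇔adj : ∀ a b → a ≢ b → (Alternate a b w ⇔ (adj G a b ≡ true))) where

  rank : Fin n → ℕ
  rank x = position x σ

  earlier : Fin n → Fin n → Bool
  earlier v x = rank x <ᵇ rank v

  cut : ∀ v → SingleBlock (earlier v) w
  cut v = blocks≤1⇒SingleBlock (earlier v) w (subst (_≤ 1) (markedBlocks-position σ-complete (rank v) w)
            (one-local (rank v) (<⇒≤ (position-< (σ-complete v)))))

  before-count after-count : Fin n → ℕ
  before-count v = count v (SingleBlock.before (cut v))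
  after-count  v = count v (SingleBlock.after (cut v))

  Tight : Fin n → Set
  Tight v = before-count v ≤ 1 × after-count v ≤ 1

  block-avoids-self : ∀ v → All (_≢ v) (SingleBlock.block (cut v))
  block-avoids-self v = ≢-by-mark {mark = earlier v} (not-¬ (<ᵇ-irrefl (rank v))) (SingleBlock.block-marked (cut v))

  count≡before+after : ∀ v → count v w ≡ before-count v + after-count v
  count≡before+after v = trans (cong (count v) split) (count-around v before after (block-avoids-self v))
    where open SingleBlock (cut v)

  adj⇔once×tight : ∀ {u v} → rank u < rank v → adj G u v ≡ true ⇔ (count u w ≡ 1 × Tight v)
  adj⇔once×tight {u} {v} u<v =
    subst (λ c → Alternate u v w ⇔ (c ≡ 1 × Tight v)) (sym count-u) alternate⇔
    ⇔-∘ ⇔-sym (alternate⇔adj u v u≢v)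
    where
    open SingleBlock (cut v)
    u≢v : u ≢ v
    u≢v u≡v = <-irrefl (cong rank u≡v) u<v
    u-marked : earlier v u ≢ false
    u-marked = not-¬ (Equivalence.to T-≡ (<⇒<ᵇ u<v))
    before≢u = ≢-by-mark {mark = earlier v} u-marked before-unmarked
    after≢u  = ≢-by-mark {mark = earlier v} u-marked after-unmarked
    count-u : count u w ≡ count u block
    count-u = trans (cong (count u) split) (count-sandwich u block before≢u after≢u)
    alternate⇔ : Alternate u v w ⇔ (count u block ≡ 1 × Tight v)
    alternate⇔ = subst (λ w′ → Alternate u v w′ ⇔ (count u block ≡ 1 × Tight v)) (sym split)
      (Alternate-sandwich before block after u≢v before≢u (block-avoids-self v) after≢u
        (subst (0 <_) count-u (∈⇒count>0 u (w-complete u)))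
        (subst (0 <_) (count≡before+after v) (∈⇒count>0 v (w-complete v))))

  once? : ∀ u → Dec (count u w ≡ 1)
  once? u = count u w ≟ℕ 1

  tight? : ∀ v → Dec (Tight v)
  tight? v = before-count v ≤? 1 ×-dec after-count v ≤? 1

  once⇒tight : ∀ v → count v w ≡ 1 → Tight v
  once⇒tight v once = subst (before-count v ≤_) sum≡1 (m≤m+n _ _) , subst (after-count v ≤_) sum≡1 (m≤n+m _ _)
    where sum≡1 = trans (sym (count≡before+after v)) once

  sends⇒receives : ∀ v → does (once? v) ≡ true → does (tight? v) ≡ true
  sends⇒receives v sends = dec-true (tight? v) (once⇒tight v (does-true (once? v) sends))

  ranking : ThresholdRanking G
  ranking = record
    { rank           = rank
    ; rank-injective = position-injective (σ-complete _) (σ-complete _)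
    ; sends          = does ∘ once?
    ; receives       = does ∘ tight?
    ; sends⇒receives = sends⇒receives
    ; adj-ranked     = λ u v u<v → ≡-does (once? u ×-dec tight? v) (adj⇔once×tight u<v)
    }

InL1⇒IsThreshold : ∀ {n} {G : Graph n} → InL 1 G → IsThreshold G
InL1⇒IsThreshold {G = G} (w , (σ , (_ , σ⇔w) , one-local) , w-complete , alternate⇔adj) =
  ranking⇒threshold (OneLocalRepresentation.ranking {G = G} σ-complete one-local w-complete alternate⇔adj)
  where
  σ-complete : ∀ x → x ∈ σ
  σ-complete x = Equivalence.from (σ⇔w x) (w-complete x)

module _ {m n} {g : Fin m → Fin n} (g-injective : Injective _≡_ _≡_ g) where

  elemᵇ-map : ∀ x σ → elemᵇ (g x) (map g σ) ≡ elemᵇ x σ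
  elemᵇ-map x []      = refl
  elemᵇ-map x (y ∷ σ) = cong₂ _∨_ (⌊≟⌋-map g-injective x y) (elemᵇ-map x σ)

  markedBlocks-map : ∀ i σ w → markedBlocks (take i (map g σ)) (map g w) ≡ markedBlocks (take i σ) w
  markedBlocks-map i σ w = trans (cong (λ τ → markedBlocks τ (map g w)) (take-map i σ))
                                 (blocksFrom-map (λ x → elemᵇ-map x (take i σ)) false w)

  IsMarkingSequence-map : ∀ {w σ} → IsMarkingSequence w σ → IsMarkingSequence (map g w) (map g σ)
  IsMarkingSequence-map {w} {σ} (unique , σ⇔w) =
    Unique.map⁺ g-injective unique ,
    λ x → mk⇔ (∈-map-mono (Equivalence.to (σ⇔w _))) (∈-map-mono (Equivalence.from (σ⇔w _)))
    where
    ∈-map-mono : ∀ {l l′ x} → (∀ {y} → y ∈ l → y ∈ l′) → x ∈ map g l → x ∈ map g l′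
    ∈-map-mono l⊆l′ x∈ with ∈-map⁻ g x∈
    ... | y , y∈l , refl = ∈-map⁺ g (l⊆l′ y∈l)

  IsLocal-map : ∀ {k w} → IsLocal k w → IsLocal k (map g w)
  IsLocal-map {k} {w} (σ , marking , local) = map g σ , IsMarkingSequence-map marking , λ i i≤ →
    subst (_≤ k) (sym (markedBlocks-map i σ w)) (local i (subst (i ≤_) (length-map g σ) i≤))

InL-≅ : ∀ {k n} {G H : Graph n} → G ≅ H → InL k H → InL k G
InL-≅ {G = G} {H} (π , G≅H) (w , local , w-complete , alternate⇔adj) =
  map g w , IsLocal-map g-injective local , complete , alternate⇔adjG
  where
  g = π ⟨$⟩ˡ_
  g-injective = Injection.injective (↔⇒↣ (flip π))
  complete : ∀ x → x ∈ map g w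
  complete x = subst (_∈ map g w) (inverseˡ π) (∈-map⁺ g (w-complete (π ⟨$⟩ʳ x)))
  alternate⇔adjG : ∀ a b → a ≢ b → Alternate a b (map g w) ⇔ (adj G a b ≡ true)
  alternate⇔adjG a b a≢b = alternate⇔adjH ⇔-∘ renamed
    where
    a′ = π ⟨$⟩ʳ a
    b′ = π ⟨$⟩ʳ b
    renamed : Alternate a b (map g w) ⇔ Alternate a′ b′ w
    renamed = subst₂ (λ x y → Alternate x y (map g w) ⇔ Alternate a′ b′ w) (inverseˡ π) (inverseˡ π)
      (Alternate-map g-injective {w = map g w} {w} (restrict-map g-injective a′ b′ w))
    alternate⇔adjH : Alternate a′ b′ w ⇔ (adj G a b ≡ true)
    alternate⇔adjH = subst (λ c → Alternate a′ b′ w ⇔ (c ≡ true)) (sym (G≅H a b))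
      (alternate⇔adj a′ b′ (a≢b ∘ Injection.injective (↔⇒↣ π)))

-- From threshold graphs to 1-local words

-- Vertex 0 is the newest one, so stage i marks the i newest vertices, as the marking
-- sequence allFin does.
stage : ∀ {n} → ℕ → Fin n → Bool
stage i x = toℕ x <ᵇ i

record ThresholdWord {n} (H : Graph n) : Set where
  field
    left right         : Word n
    left-once          : ∀ v → count v left ≡ 1
    right-at-most-once : ∀ v → count v right ≤ 1
    alternate⇔adj      : ∀ a b → a ≢ b → (Alternate a b (left ++ right) ⇔ (adj H a b ≡ true))
    left-split         : ∀ i → Split (Unmarked (stage i)) (Marked (stage i)) left
    right-split        : ∀ i → Split (Marked (stage i)) (Unmarked (stage i)) right

newcomer : ∀ {n} → Bool → Word (suc n)
newcomer true  = []
newcomer false = zero ∷ []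

suc-avoids-zero : ∀ {n} (w : Word n) → All (λ (x : Fin (suc n)) → x ≢ zero) (map suc w)
suc-avoids-zero []      = []
suc-avoids-zero (x ∷ w) = (λ ()) ∷ suc-avoids-zero w

newcomer-count-zero : ∀ {n} β → count zero (newcomer {n} β) ≤ 1
newcomer-count-zero true  = z≤n
newcomer-count-zero false = s≤s z≤n

newcomer-count-suc : ∀ {n} β (v : Fin n) w → count (suc v) (newcomer β ++ w) ≡ count (suc v) w
newcomer-count-suc true  v w = refl
newcomer-count-suc false v w = refl

newcomer-avoids-suc : ∀ {n} β (v : Fin n) → All (_≢ suc v) (zero ∷ newcomer β)
newcomer-avoids-suc true  v = (λ ()) ∷ []
newcomer-avoids-suc false v = (λ ()) ∷ (λ ()) ∷ []

newcomer-restrict-suc : ∀ {n} β (a b : Fin n) w →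
  restrict (suc a) (suc b) ((zero ∷ newcomer β) ++ w) ≡ restrict (suc a) (suc b) w
newcomer-restrict-suc true  a b w = refl
newcomer-restrict-suc false a b w = refl

newcomer-marked : ∀ {n} β i → All (Marked (stage (suc i))) (newcomer {n} β)
newcomer-marked true  i = []
newcomer-marked false i = refl ∷ []

once⇔dominating : ∀ {n} β {X : Set} → X → (count zero (zero ∷ newcomer {n} β) ≡ 1 × X) ⇔ (β ≡ true)
once⇔dominating true  x = mk⇔ (λ _ → refl) (λ _ → refl , x)
once⇔dominating false x = mk⇔ (λ { (() , _) }) (λ ())

module Extension {n} {H : Graph n} (β : Bool) (T : ThresholdWord H) where
  open ThresholdWord T

  left′ right′ : Word (suc n)
  left′  = map suc left ++ zero ∷ []
  right′ = newcomer β ++ map suc right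

  left′-once : ∀ v → count v left′ ≡ 1
  left′-once zero    = trans (count-++ zero (map suc left) (zero ∷ []))
                             (cong (_+ 1) (count-absent zero (suc-avoids-zero left)))
  left′-once (suc v) = begin
    count (suc v) left′                        ≡⟨ count-++ (suc v) (map suc left) (zero ∷ []) ⟩
    count (suc v) (map suc left) + 0          ≡⟨ +-identityʳ _ ⟩
    count (suc v) (map suc left)              ≡⟨ count-map suc-injective v left ⟩
    count v left                              ≡⟨ left-once v ⟩
    1                                         ∎
    where open ≡-Reasoning

  right′-at-most-once : ∀ v → count v right′ ≤ 1
  right′-at-most-once zero    = subst (_≤ 1) (sym count≡) (newcomer-count-zero β)
    where
    count≡ : count zero right′ ≡ count zero (newcomer {n} β)
    count≡ = trans (count-++ zero (newcomer β) (map suc right))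
               (trans (cong (count zero (newcomer β) +_) (count-absent zero (suc-avoids-zero right))) (+-identityʳ _))
  right′-at-most-once (suc v) = subst (_≤ 1) (sym count≡) (right-at-most-once v)
    where
    count≡ : count (suc v) right′ ≡ count v right
    count≡ = trans (newcomer-count-suc β v (map suc right)) (count-map suc-injective v right)

  word′ : left′ ++ right′ ≡ map suc left ++ (zero ∷ newcomer β) ++ map suc right
  word′ = ++-assoc (map suc left) (zero ∷ []) right′

  alternate-zero : ∀ j → Alternate zero (suc j) (left′ ++ right′) ⇔ (adj (addVertex β H) zero (suc j) ≡ true)
  alternate-zero j = condition⇔adj ⇔-∘ alternate⇔condition
    where
    j-left : count (suc j) (map suc left) ≡ 1
    j-left = trans (count-map suc-injective j left) (left-once j)
    j-right : count (suc j) (map suc right) ≤ 1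
    j-right = subst (_≤ 1) (sym (count-map suc-injective j right)) (right-at-most-once j)
    Condition = count zero (zero ∷ newcomer β) ≡ 1
              × count (suc j) (map suc left) ≤ 1 × count (suc j) (map suc right) ≤ 1
    alternate⇔condition : Alternate zero (suc j) (left′ ++ right′) ⇔ Condition
    alternate⇔condition = subst (λ w → Alternate zero (suc j) w ⇔ Condition) (sym word′)
      (Alternate-sandwich (map suc left) (zero ∷ newcomer β) (map suc right) (λ ())
         (suc-avoids-zero left) (newcomer-avoids-suc β j) (suc-avoids-zero right)
         (s≤s z≤n) (subst (λ c → 0 < c + count (suc j) (map suc right)) (sym j-left) (s≤s z≤n)))
    condition⇔adj : Condition ⇔ (adj (addVertex β H) zero (suc j) ≡ true)
    condition⇔adj = subst (λ b → Condition ⇔ (b ≡ true)) (sym (addVertex-zero-suc β H j))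
      (once⇔dominating β (subst (_≤ 1) (sym j-left) ≤-refl , j-right))

  restrict-suc : ∀ a b → restrict (suc a) (suc b) (left′ ++ right′) ≡ map suc (restrict a b (left ++ right))
  restrict-suc a b = begin
    restrict (suc a) (suc b) (left′ ++ right′)
      ≡⟨ cong (restrict (suc a) (suc b)) word′ ⟩
    restrict (suc a) (suc b) (map suc left ++ (zero ∷ newcomer β) ++ map suc right)
      ≡⟨ restrict-++ (suc a) (suc b) (map suc left) _ ⟩
    restrict (suc a) (suc b) (map suc left) ++ restrict (suc a) (suc b) ((zero ∷ newcomer β) ++ map suc right)
      ≡⟨ cong₂ _++_ (restrict-map suc-injective a b left)
                    (trans (newcomer-restrict-suc β a b (map suc right)) (restrict-map suc-injective a b right)) ⟩
    map suc (restrict a b left) ++ map suc (restrict a b right)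
      ≡⟨ sym (map-++ suc (restrict a b left) (restrict a b right)) ⟩
    map suc (restrict a b left ++ restrict a b right)
      ≡⟨ cong (map suc) (sym (restrict-++ a b left right)) ⟩
    map suc (restrict a b (left ++ right)) ∎
    where open ≡-Reasoning

  alternate⇔adj′ : ∀ a b → a ≢ b → Alternate a b (left′ ++ right′) ⇔ (adj (addVertex β H) a b ≡ true)
  alternate⇔adj′ zero    zero    0≢0 = ⊥-elim (0≢0 refl)
  alternate⇔adj′ zero    (suc j) _   = alternate-zero j
  alternate⇔adj′ (suc i) zero    _   =
    subst (λ b → Alternate zero (suc i) (left′ ++ right′) ⇔ (b ≡ true))
          (Graph.sym (addVertex β H) zero (suc i)) (alternate-zero i)
    ⇔-∘ mk⇔ (Alternate-sym {w = left′ ++ right′}) (Alternate-sym {w = left′ ++ right′})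
  alternate⇔adj′ (suc i) (suc j) i≢j =
    subst (λ b → Alternate i j (left ++ right) ⇔ (b ≡ true))
          (sym (addVertex-suc-suc β H i j)) (alternate⇔adj i j (i≢j ∘ cong suc))
    ⇔-∘ Alternate-map suc-injective {w = left′ ++ right′} {left ++ right} (restrict-suc i j)

  left′-split : ∀ i → Split (Unmarked (stage i)) (Marked (stage i)) left′
  left′-split zero    = Split-front (All.universal (λ _ → refl) left′)
  left′-split (suc i) = Split-append (Split-map (left-split i)) (refl ∷ [])

  right′-split : ∀ i → Split (Marked (stage i)) (Unmarked (stage i)) right′
  right′-split zero    = Split-back (All.universal (λ _ → refl) right′)
  right′-split (suc i) = Split-prepend (newcomer-marked β i) (Split-map (right-split i))

  extended : ThresholdWord (addVertex β H)
  extended = record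
    { left = left′ ; right = right′ ; left-once = left′-once ; right-at-most-once = right′-at-most-once
    ; alternate⇔adj = alternate⇔adj′ ; left-split = left′-split ; right-split = right′-split }

constructed⇒ThresholdWord : ∀ {n} {H : Graph n} → Constructed n H → ThresholdWord H
constructed⇒ThresholdWord empty = record
  { left = [] ; right = [] ; left-once = λ () ; right-at-most-once = λ () ; alternate⇔adj = λ ()
  ; left-split = λ _ → Split-front [] ; right-split = λ _ → Split-front [] }
constructed⇒ThresholdWord (isolated   c) = Extension.extended false (constructed⇒ThresholdWord c)
constructed⇒ThresholdWord (dominating c) = Extension.extended true  (constructed⇒ThresholdWord c)

ThresholdWord⇒InL1 : ∀ {n} {H : Graph n} → ThresholdWord H → InL 1 H
ThresholdWord⇒InL1 {n} T = left ++ right , (allFin n , marking , one-local) , complete , alternate⇔adj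
  where
  open ThresholdWord T
  complete : ∀ x → x ∈ left ++ right
  complete x = ∈-++⁺ˡ (count>0⇒∈ x {left} (subst (0 <_) (sym (left-once x)) (s≤s z≤n)))
  marking : IsMarkingSequence (left ++ right) (allFin n)
  marking = Unique.allFin⁺ n , λ x → mk⇔ (λ _ → complete x) (λ _ → ∈-allFin x)
  one-local : ∀ i → i ≤ length (allFin n) → markedBlocks (take i (allFin n)) (left ++ right) ≤ 1
  one-local i _ = subst (_≤ 1) (sym blocks≡)
    (SingleBlock⇒blocks≤1 (stage i) (Splits⇒SingleBlock (left-split i) (right-split i)))
    where
    blocks≡ : markedBlocks (take i (allFin n)) (left ++ right) ≡ blocksFrom false (stage i) (left ++ right)
    blocks≡ = trans (markedBlocks-position ∈-allFin i (left ++ right))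
                    (blocksFrom-cong (λ x → cong (_<ᵇ i) (position-allFin x)) false (left ++ right))

mainTheorem2 : ∀ (n : ℕ) (G : Graph n) → InL 1 G ⇔ IsThreshold G
mainTheorem2 n G = mk⇔ (InL1⇒IsThreshold {G = G}) λ (H , constructed , G≅H) →
  InL-≅ {G = G} {H} G≅H (ThresholdWord⇒InL1 (constructed⇒ThresholdWord constructed))
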